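{- Let $0\le\alpha<1$ and suppose that $\textsc{ProbeExt}(m,p,\alpha)$ (or $\textsc{ProbeExtB}(m,p,\alpha)$) performs $i$ merge operations on the input stream, where $i\ge 2$. Then its output bottleneck value $B$ satisfies $$\frac{B}{B^*}\le 2+\frac{2(\alpha+i)}{2^{i-1}(1+\alpha)-i-\alpha},$$ where $B^*$ is the optimal bottleneck value.
   Context: Problem: the input is a stream $X=(X_1,\dots,X_n)\in\{0,1,\dots,m\}^n$ whose maximum element $m$ is known in advance, and an integer $p\ge 2$. A partitioning is given by separators $1=s_0\le s_1\le\dots\le s_{p-1}\le s_p=n+1$; its bottleneck value is $\max_{j}\sum_{i=s_j}^{s_{j+1}-1}X_i$, and $B^*$ is the minimum bottleneck value. $\textsc{ProbeExt}(m,p,\alpha)$: maintains a current bottleneck value $B$, initially $m(1+\alpha)$, closed partitions and an open partition of weight $W$ (initially empty). For each element $x$: if $W+x\le B$, $x$ is added to the open partition. Otherwise, if the open partition is the $P$-th partition with $P<p$, the open partition is closed and a new open partition containing only $x$ is started. Otherwise (the open partition is the $p$-th) a merge operation is performed: the open partition is closed, $B$ is doubled, and closed partitions $2k-1$ and $2k$ are merged for $k=1,\dots,\lfloor p/2\rfloor$; if $p$ is even, a new open partition containing only $x$ is started (as partition $p/2+1$); if $p$ is odd, partition $p$ together with $x$ becomes the open partition (as partition $(p+1)/2$). At the end it outputs the final $B$ (equal to $2^i m(1+\alpha)$ after $i$ merges) as its bottleneck value, together with the separators. $\textsc{ProbeExtB}$ is identical but stores no separators and outputs only $B$.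
   Formalization: The parameter α ranges over the rationals with $0\le\alpha<1$ instead of the reals. -}

module Defs where

open import Data.Bool using (Bool; true; false; if_then_else_)
open import Data.Nat as ℕ using (ℕ; zero; suc; _<ᵇ_)
open import Data.Integer using (+_)
open import Data.List using (List; []; _∷_; _++_; [_]; length; concat)
open import Data.Nat.ListAction using (sum)
open import Data.List.Membership.Propositional using (_∈_)
open import Data.List.Relation.Unary.All using (All)
open import Data.Vec as Vec using (Vec)
open import Data.Product using (_×_; _,_; Σ; ∃)
open import Data.Rational as ℚ using (ℚ; _≤ᵇ_; 1ℚ)
open import Relation.Binary.PropositionalEquality using (_≡_)

⟦_⟧ : ℕ → ℚ
⟦ n ⟧ = + n ℚ./ 1

IsMax : ℕ → List ℕ → Set
IsMax m X = (m ∈ X) × All (λ x → x ℕ.≤ m) X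

-- A partitioning of X into p consecutive (possibly empty) intervals,
-- i.e. separators 1 = s₀ ≤ s₁ ≤ … ≤ s_p = n+1, is a vector of p lists
-- whose concatenation is X.

Partitioning : List ℕ → ℕ → Set
Partitioning X p = Σ (Vec (List ℕ) p) (λ parts → concat (Vec.toList parts) ≡ X)

bottleneck : ∀ {X p} → Partitioning X p → ℕ
bottleneck (parts , _) = Vec.foldr _ (λ part acc → sum part ℕ.⊔ acc) 0 parts

IsOptimalBottleneck : List ℕ → ℕ → ℕ → Set
IsOptimalBottleneck X p b =
  (Σ (Partitioning X p) (λ P → bottleneck P ≡ b)) ×
  ((P : Partitioning X p) → b ℕ.≤ bottleneck P)

-- ProbeExtB(m, p, α) (weights only; ProbeExt computes the same B).

record State : Set where
  constructor st
  field
    curB    : ℚ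
    closed  : List ℕ
    openW   : ℕ
    merges  : ℕ

-- merge closed partitions 2k-1 and 2k; a leftover odd last partition,
-- together with x, becomes the open partition; otherwise x alone opens
-- a new partition.
mergeStep : List ℕ → ℕ → List ℕ × ℕ
mergeStep (a ∷ b ∷ r) x with mergeStep r x
... | (c , w) = (a ℕ.+ b) ∷ c , w
mergeStep (a ∷ []) x = [] , a ℕ.+ x
mergeStep [] x = [] , x

step : ℕ → State → ℕ → State
step p (st B cl W i) x =
  if ⟦ W ℕ.+ x ⟧ ≤ᵇ B then st B cl (W ℕ.+ x) i
  else if suc (length cl) <ᵇ p then st B (cl ++ [ W ]) x i
  else (let r = mergeStep (cl ++ [ W ]) x
        in st (⟦ 2 ⟧ ℚ.* B) (Data.Product.proj₁ r) (Data.Product.proj₂ r) (suc i))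

initState : ℕ → ℚ → State
initState m α = st (⟦ m ⟧ ℚ.* (1ℚ ℚ.+ α)) [] 0 0

runFrom : ℕ → State → List ℕ → State
runFrom p s [] = s
runFrom p s (x ∷ xs) = runFrom p (step p s x) xs

probeExtB : ℕ → ℕ → ℚ → List ℕ → State
probeExtB m p α X = runFrom p (initState m α) X

outputB : ℕ → ℕ → ℚ → List ℕ → ℚ
outputB m p α X = State.curB (probeExtB m p α X)

numMerges : ℕ → ℕ → ℚ → List ℕ → ℕ
numMerges m p α X = State.merges (probeExtB m p α X)

module Submission where

-- Let b = m(1 + α) be the initial bottleneck value, so that the output is
-- B = 2^i · b.  Every partition closed with bottleneck value B′ overflowed
-- by an element x ≤ m, hence weighs at least B′ − m; merging two such
-- partitions gives a partition of weight at least 2B′ − 2m for the doubled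
-- bottleneck.  We track this as an invariant of the run ('Invariant'):
-- the closed partitions fall short of full weight by a bounded multiple of
-- m in total ('slack'), and the p partitions merged by the last merge were
-- nearly full for bottleneck B/2 ('after-merge'), i.e.
--     p · B ≤ 2 (ΣX + i·p·m).
-- Since ΣX ≤ p · B* for the optimal partitioning, this gives
-- B/2 = 2^(i−1) m (1 + α) ≤ B* + i m, i.e. m·D ≤ B* for
-- D = 2^(i−1)(1 + α) − i − α.  Writing B = 2 m D + 2 (α + i) m and using
-- m ≤ B*/D yields B ≤ (2 + 2(α + i)/D) · B*.

open import Defs
open import Data.Nat as ℕ using (ℕ; _≤_; _^_; _∸_)
open import Data.List using (List)
open import Data.Rational as ℚ using (ℚ; 0ℚ; 1ℚ; _+_; _*_; _-_; 1/_; >-nonZero)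
open import Relation.Binary.PropositionalEquality using (_≡_)

open import Data.Bool using (T; true; false)
open import Data.Nat using (suc; zero; s≤s; z≤n; z<s; _<ᵇ_)
import Data.Nat.Properties as ℕ
open import Data.Nat.Tactic.RingSolver using (solve-∀)
open import Data.List using ([]; _∷_; _++_; [_]; length; concat)
open import Data.List.Properties using (length-++)
open import Data.List.Relation.Unary.All using (All; []; _∷_)
open import Data.Nat.ListAction using (sum)
open import Data.Nat.ListAction.Properties using (sum-++)
open import Data.Vec as Vec using (Vec)
open import Data.Product using (_,_; proj₁; proj₂)
open import Data.Maybe using (Maybe; just; nothing)
import Data.Integer as ℤ
import Data.Integer.Properties as ℤ
open import Data.Rational using (toℚᵘ; -_; _≤ᵇ_; positive; nonNegative)
open import Data.Rational.Properties
import Data.Rational.Unnormalised as ℚᵘ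
import Data.Rational.Unnormalised.Properties as ℚᵘ
open import Data.Nat.Coprimality using (1-coprimeTo) renaming (sym to coprime-sym)
open import Relation.Binary.PropositionalEquality
  using (refl; sym; trans; cong; cong₂; subst; subst₂; module ≡-Reasoning)
open import Relation.Nullary using (yes; no)
open import Tactic.RingSolver using () renaming (solve-∀ to solve-∀-in)
open import Tactic.RingSolver.Core.AlmostCommutativeRing
  using (AlmostCommutativeRing; fromCommutativeRing)

toℚᵘ-⟦⟧ : ∀ n → toℚᵘ ⟦ n ⟧ ≡ ℚᵘ.mkℚᵘ (ℤ.+ n) 0
toℚᵘ-⟦⟧ n = cong toℚᵘ (normalize-coprime {n} {0} (coprime-sym (1-coprimeTo n)))

⟦⟧-homo-+ : ∀ a b → ⟦ a ℕ.+ b ⟧ ≡ ⟦ a ⟧ + ⟦ b ⟧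
⟦⟧-homo-+ a b = toℚᵘ-injective (begin
  toℚᵘ ⟦ a ℕ.+ b ⟧                ≈⟨ ℚᵘ.≃-reflexive (toℚᵘ-⟦⟧ (a ℕ.+ b)) ⟩
  ℚᵘ.mkℚᵘ (ℤ.+ (a ℕ.+ b)) 0       ≈⟨ ℚᵘ.*≡* (cong (ℤ._* ℤ.+ 1) (trans (ℤ.pos-+ a b)
                                       (sym (cong₂ ℤ._+_ (ℤ.*-identityʳ (ℤ.+ a)) (ℤ.*-identityʳ (ℤ.+ b)))))) ⟩
  ℚᵘ.mkℚᵘ (ℤ.+ a) 0 ℚᵘ.+ ℚᵘ.mkℚᵘ (ℤ.+ b) 0
                                  ≈⟨ ℚᵘ.≃-reflexive (sym (cong₂ ℚᵘ._+_ (toℚᵘ-⟦⟧ a) (toℚᵘ-⟦⟧ b))) ⟩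
  toℚᵘ ⟦ a ⟧ ℚᵘ.+ toℚᵘ ⟦ b ⟧      ≈⟨ ℚᵘ.≃-sym (toℚᵘ-homo-+ ⟦ a ⟧ ⟦ b ⟧) ⟩
  toℚᵘ (⟦ a ⟧ + ⟦ b ⟧)            ∎)
  where open ℚᵘ.≃-Reasoning

⟦⟧-homo-* : ∀ a b → ⟦ a ℕ.* b ⟧ ≡ ⟦ a ⟧ * ⟦ b ⟧
⟦⟧-homo-* a b = toℚᵘ-injective (begin
  toℚᵘ ⟦ a ℕ.* b ⟧                ≈⟨ ℚᵘ.≃-reflexive (toℚᵘ-⟦⟧ (a ℕ.* b)) ⟩
  ℚᵘ.mkℚᵘ (ℤ.+ (a ℕ.* b)) 0       ≈⟨ ℚᵘ.*≡* (cong (ℤ._* ℤ.+ 1) (ℤ.pos-* a b)) ⟩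
  ℚᵘ.mkℚᵘ (ℤ.+ a) 0 ℚᵘ.* ℚᵘ.mkℚᵘ (ℤ.+ b) 0
                                  ≈⟨ ℚᵘ.≃-reflexive (sym (cong₂ ℚᵘ._*_ (toℚᵘ-⟦⟧ a) (toℚᵘ-⟦⟧ b))) ⟩
  toℚᵘ ⟦ a ⟧ ℚᵘ.* toℚᵘ ⟦ b ⟧      ≈⟨ ℚᵘ.≃-sym (toℚᵘ-homo-* ⟦ a ⟧ ⟦ b ⟧) ⟩
  toℚᵘ (⟦ a ⟧ * ⟦ b ⟧)            ∎)
  where open ℚᵘ.≃-Reasoning

⟦⟧-mono-≤ : ∀ a b → a ≤ b → ⟦ a ⟧ ℚ.≤ ⟦ b ⟧
⟦⟧-mono-≤ a b a≤b = toℚᵘ-cancel-≤ (subst₂ ℚᵘ._≤_ (sym (toℚᵘ-⟦⟧ a)) (sym (toℚᵘ-⟦⟧ b))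
  (ℚᵘ.*≤* (subst₂ ℤ._≤_ (sym (ℤ.*-identityʳ (ℤ.+ a))) (sym (ℤ.*-identityʳ (ℤ.+ b))) (ℤ.+≤+ a≤b))))

⟦⟧-nonNeg : ∀ n → 0ℚ ℚ.≤ ⟦ n ⟧
⟦⟧-nonNeg n = ⟦⟧-mono-≤ 0 n z≤n

sum-concat≤ : ∀ {n} (parts : Vec (List ℕ) n) →
  sum (concat (Vec.toList parts)) ≤ n ℕ.* Vec.foldr (λ _ → ℕ) (λ part acc → sum part ℕ.⊔ acc) 0 parts
sum-concat≤ Vec.[] = z≤n
sum-concat≤ {suc n} (part Vec.∷ parts) = begin
  sum (part ++ concat (Vec.toList parts))       ≡⟨ sum-++ part (concat (Vec.toList parts)) ⟩
  sum part ℕ.+ sum (concat (Vec.toList parts))  ≤⟨ ℕ.+-mono-≤ (ℕ.m≤m⊔n (sum part) heaviest)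
                                                     (ℕ.≤-trans (sum-concat≤ parts) (ℕ.*-monoʳ-≤ n (ℕ.m≤n⊔m (sum part) heaviest))) ⟩
  (sum part ℕ.⊔ heaviest) ℕ.+ n ℕ.* (sum part ℕ.⊔ heaviest) ∎
  where
    open ℕ.≤-Reasoning
    heaviest : ℕ
    heaviest = Vec.foldr (λ _ → ℕ) (λ part acc → sum part ℕ.⊔ acc) 0 parts

sum≤p*bottleneck : ∀ {X p} (P : Partitioning X p) → sum X ≤ p ℕ.* bottleneck P
sum≤p*bottleneck (parts , refl) = sum-concat≤ parts

pair-regroup : ∀ a b s t → a ℕ.+ b ℕ.+ (s ℕ.+ t) ≡ a ℕ.+ (b ℕ.+ s) ℕ.+ t
pair-regroup = solve-∀

mergeStep-weight : ∀ ps x →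
  sum (proj₁ (mergeStep ps x)) ℕ.+ proj₂ (mergeStep ps x) ≡ sum ps ℕ.+ x
mergeStep-weight []           x = refl
mergeStep-weight (a ∷ [])     x = cong (ℕ._+ x) (sym (ℕ.+-identityʳ a))
mergeStep-weight (a ∷ b ∷ ps) x with mergeStep ps x | mergeStep-weight ps x
... | c , w | eq = begin
  a ℕ.+ b ℕ.+ sum c ℕ.+ w       ≡⟨ ℕ.+-assoc (a ℕ.+ b) (sum c) w ⟩
  a ℕ.+ b ℕ.+ (sum c ℕ.+ w)     ≡⟨ cong (a ℕ.+ b ℕ.+_) eq ⟩
  a ℕ.+ b ℕ.+ (sum ps ℕ.+ x)    ≡⟨ pair-regroup a b (sum ps) x ⟩
  a ℕ.+ (b ℕ.+ sum ps) ℕ.+ x    ∎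
  where open ≡-Reasoning

-- The two possible outcomes of merging the partitions cl ++ [ W ] pairwise:
-- either all of them are paired up (cl has odd length), or W is left over
-- and re-opened together with x (cl has even length).
data MergeShape (cl : List ℕ) (W : ℕ) (c : List ℕ) : Set where
  all-paired : sum c ≡ sum cl ℕ.+ W → 2 ℕ.* length c ≡ suc (length cl) → MergeShape cl W c
  open-left  : sum c ≡ sum cl       → 2 ℕ.* length c ≡ length cl       → MergeShape cl W c

two-more : ∀ {n} (c : List ℕ) → 2 ℕ.* length c ≡ n → 2 ℕ.* suc (length c) ≡ suc (suc n)
two-more c l = trans (ℕ.*-distribˡ-+ 2 1 (length c)) (cong (2 ℕ.+_) l)

mergeStep-shape : ∀ cl W x → MergeShape cl W (proj₁ (mergeStep (cl ++ [ W ]) x))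
mergeStep-shape []           W x = open-left refl refl
mergeStep-shape (a ∷ [])     W x = all-paired (single-pair a W) refl
  where single-pair : ∀ a W → a ℕ.+ W ℕ.+ 0 ≡ a ℕ.+ 0 ℕ.+ W
        single-pair = solve-∀
mergeStep-shape (a ∷ b ∷ cl) W x with mergeStep (cl ++ [ W ]) x | mergeStep-shape cl W x
... | c , w | all-paired s l =
  all-paired (trans (cong (a ℕ.+ b ℕ.+_) s) (pair-regroup a b (sum cl) W)) (two-more c l)
... | c , w | open-left s l =
  open-left (trans (cong (a ℕ.+ b ℕ.+_) s) (ℕ.+-assoc a b (sum cl))) (two-more c l)

half-< : ∀ c n → 2 ℕ.* c ≤ suc n → c ℕ.< suc n
half-< zero      n _ = z<s
half-< c@(suc _) n h = ℕ.<-≤-trans (subst (c ℕ.<_) (ℕ.*-comm c 2) (ℕ.m<m*n c 2 (s≤s (s≤s z≤n)))) h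

merged-fewer : ∀ {cl W c} → MergeShape cl W c → length c ℕ.< suc (length cl)
merged-fewer {cl} {c = c} (all-paired _ l) = half-< (length c) (length cl) (ℕ.≤-reflexive l)
merged-fewer {cl} {c = c} (open-left _ l)  =
  half-< (length c) (length cl) (ℕ.≤-trans (ℕ.≤-reflexive l) (ℕ.n≤1+n (length cl)))

-- Nearly full partitions are tracked by bounds  n · B ≤ s + A, where n
-- partitions of bottleneck value B have total weight s and A bounds their
-- total shortfall (in the invariant, A = (allowance) · m).
extend-slack : ∀ n B s A w → ⟦ n ⟧ * B ℚ.≤ ⟦ s ℕ.+ A ⟧ → B ℚ.≤ ⟦ w ⟧ →
  ⟦ suc n ⟧ * B ℚ.≤ ⟦ s ℕ.+ w ℕ.+ A ⟧
extend-slack n B s A w nB≤ B≤w = begin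
  ⟦ suc n ⟧ * B           ≡⟨ cong (_* B) (⟦⟧-homo-+ 1 n) ⟩
  (1ℚ + ⟦ n ⟧) * B        ≡⟨ *-distribʳ-+ B 1ℚ ⟦ n ⟧ ⟩
  1ℚ * B + ⟦ n ⟧ * B      ≡⟨ cong (_+ ⟦ n ⟧ * B) (*-identityˡ B) ⟩
  B + ⟦ n ⟧ * B           ≤⟨ +-mono-≤ B≤w nB≤ ⟩
  ⟦ w ⟧ + ⟦ s ℕ.+ A ⟧     ≡⟨ sym (⟦⟧-homo-+ w (s ℕ.+ A)) ⟩
  ⟦ w ℕ.+ (s ℕ.+ A) ⟧     ≡⟨ cong ⟦_⟧ (swap w s A) ⟩
  ⟦ s ℕ.+ w ℕ.+ A ⟧       ∎
  where
    open ≤-Reasoning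
    swap : ∀ w s A → w ℕ.+ (s ℕ.+ A) ≡ s ℕ.+ w ℕ.+ A
    swap = solve-∀

-- Closing a partition that overflowed with an element x ≤ m: its weight W
-- satisfies B < W + x ≤ W + m, so it uses one more unit of allowance.
close-slack : ∀ n B s W m K → B ℚ.≤ ⟦ W ℕ.+ m ⟧ →
  ⟦ n ⟧ * B ℚ.≤ ⟦ s ℕ.+ (n ℕ.+ K) ℕ.* m ⟧ →
  ⟦ suc n ⟧ * B ℚ.≤ ⟦ s ℕ.+ W ℕ.+ (suc n ℕ.+ K) ℕ.* m ⟧
close-slack n B s W m K B≤ h =
  subst (λ t → ⟦ suc n ⟧ * B ℚ.≤ ⟦ t ⟧) (regroup s W m ((n ℕ.+ K) ℕ.* m))
    (extend-slack n B s ((n ℕ.+ K) ℕ.* m) (W ℕ.+ m) h B≤)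
  where
    regroup : ∀ s W m A → s ℕ.+ (W ℕ.+ m) ℕ.+ A ≡ s ℕ.+ W ℕ.+ (m ℕ.+ A)
    regroup = solve-∀

double-bottleneck : ∀ c B → ⟦ c ⟧ * (⟦ 2 ⟧ * B) ≡ ⟦ 2 ℕ.* c ⟧ * B
double-bottleneck c B = begin
  ⟦ c ⟧ * (⟦ 2 ⟧ * B)   ≡⟨ sym (*-assoc ⟦ c ⟧ ⟦ 2 ⟧ B) ⟩
  ⟦ c ⟧ * ⟦ 2 ⟧ * B     ≡⟨ cong (_* B) (*-comm ⟦ c ⟧ ⟦ 2 ⟧) ⟩
  ⟦ 2 ⟧ * ⟦ c ⟧ * B     ≡⟨ cong (_* B) (sym (⟦⟧-homo-* 2 c)) ⟩
  ⟦ 2 ℕ.* c ⟧ * B       ∎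
  where open ≡-Reasoning

record Invariant (p m : ℕ) (b : ℚ) (S : ℕ) (s : State) : Set where
  constructor invariant
  open State s
  field
    doubling    : curB ≡ ⟦ 2 ^ merges ⟧ * b
    few-closed  : length closed ℕ.< p
    weight      : sum closed ℕ.+ openW ≡ S
    -- the closed partitions are nearly full: in total they fall short of
    -- weight curB by at most m per closed partition, plus m per
    -- partition present at each earlier merge
    slack       : ⟦ length closed ⟧ * curB ℚ.≤ ⟦ sum closed ℕ.+ (length closed ℕ.+ merges ℕ.* p) ℕ.* m ⟧
    -- the p partitions merged last were nearly full for bottleneck curB / 2
    after-merge : 0 ℕ.< merges → ⟦ p ⟧ * curB ℚ.≤ ⟦ 2 ⟧ * ⟦ S ℕ.+ merges ℕ.* p ℕ.* m ⟧

initial-invariant : ∀ p m α → 0 ℕ.< p →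
  Invariant p m (⟦ m ⟧ * (1ℚ + α)) 0 (initState m α)
initial-invariant p m α 0<p = invariant
  (sym (*-identityˡ (⟦ m ⟧ * (1ℚ + α)))) 0<p refl
  (≤-reflexive (*-zeroˡ (⟦ m ⟧ * (1ℚ + α)))) (λ ())

sum-snoc : ∀ cl W → sum (cl ++ [ W ]) ≡ sum cl ℕ.+ W
sum-snoc cl W = trans (sum-++ cl [ W ]) (cong (sum cl ℕ.+_) (ℕ.+-identityʳ W))

length-snoc : ∀ (cl : List ℕ) W → length (cl ++ [ W ]) ≡ suc (length cl)
length-snoc cl W = trans (length-++ cl) (ℕ.+-comm (length cl) 1)

overflows : ∀ B w → (⟦ w ⟧ ≤ᵇ B) ≡ false → B ℚ.< ⟦ w ⟧
overflows B w fails = ≰⇒> (λ w≤B → subst T fails (≤⇒≤ᵇ w≤B))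

module _ {p m : ℕ} {b : ℚ} where

  after-merge-grow : ∀ B S x k → ⟦ p ⟧ * B ℚ.≤ ⟦ 2 ⟧ * ⟦ S ℕ.+ k ⟧ →
    ⟦ p ⟧ * B ℚ.≤ ⟦ 2 ⟧ * ⟦ S ℕ.+ x ℕ.+ k ⟧
  after-merge-grow B S x k h =
    ≤-trans h (*-monoˡ-≤-nonNeg ⟦ 2 ⟧ (⟦⟧-mono-≤ _ _ (ℕ.+-monoˡ-≤ k (ℕ.m≤m+n S x))))

  fits-preserves : ∀ {B cl W i} x → Invariant p m b (sum cl ℕ.+ W) (st B cl W i) →
    Invariant p m b (sum cl ℕ.+ W ℕ.+ x) (st B cl (W ℕ.+ x) i)
  fits-preserves {B} {cl} {W} {i} x (invariant doubling few refl slack after) =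
    invariant doubling few (sym (ℕ.+-assoc (sum cl) W x)) slack
      (λ 0<i → after-merge-grow B (sum cl ℕ.+ W) x _ (after 0<i))

  close-preserves : ∀ {B cl W i} x → x ≤ m → B ℚ.< ⟦ W ℕ.+ x ⟧ → suc (length cl) ℕ.< p →
    Invariant p m b (sum cl ℕ.+ W) (st B cl W i) →
    Invariant p m b (sum cl ℕ.+ W ℕ.+ x) (st B (cl ++ [ W ]) x i)
  close-preserves {B} {cl} {W} {i} x x≤m overflow room (invariant doubling _ refl slack after) =
    invariant doubling (subst (ℕ._< p) (sym (length-snoc cl W)) room)
      (cong (ℕ._+ x) (sum-snoc cl W)) slack′
      (λ 0<i → after-merge-grow B (sum cl ℕ.+ W) x _ (after 0<i))
    where
      slack′ : ⟦ length (cl ++ [ W ]) ⟧ * B ℚ.≤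
               ⟦ sum (cl ++ [ W ]) ℕ.+ (length (cl ++ [ W ]) ℕ.+ i ℕ.* p) ℕ.* m ⟧
      slack′ rewrite length-snoc cl W | sum-snoc cl W =
        close-slack (length cl) B (sum cl) W m (i ℕ.* p)
          (≤-trans (<⇒≤ overflow) (⟦⟧-mono-≤ _ _ (ℕ.+-monoʳ-≤ W x≤m))) slack

  merge-preserves : ∀ {B cl W i} x → x ≤ m → B ℚ.< ⟦ W ℕ.+ x ⟧ → suc (length cl) ≡ p →
    Invariant p m b (sum cl ℕ.+ W) (st B cl W i) →
    Invariant p m b (sum cl ℕ.+ W ℕ.+ x)
      (st (⟦ 2 ⟧ * B) (proj₁ (mergeStep (cl ++ [ W ]) x)) (proj₂ (mergeStep (cl ++ [ W ]) x)) (suc i))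
  merge-preserves {B} {cl} {W} {i} x x≤m overflow refl (invariant doubling _ refl slack _) =
    invariant doubling′ (merged-fewer shape) weight′ (merged-slack shape) after′
    where
      n K : ℕ
      n = length cl
      K = i ℕ.* suc n
      c : List ℕ
      c = proj₁ (mergeStep (cl ++ [ W ]) x)
      shape : MergeShape cl W c
      shape = mergeStep-shape cl W x

      doubling′ : ⟦ 2 ⟧ * B ≡ ⟦ 2 ^ suc i ⟧ * b
      doubling′ = begin
        ⟦ 2 ⟧ * B                 ≡⟨ cong (⟦ 2 ⟧ *_) doubling ⟩
        ⟦ 2 ⟧ * (⟦ 2 ^ i ⟧ * b)   ≡⟨ sym (*-assoc ⟦ 2 ⟧ ⟦ 2 ^ i ⟧ b) ⟩
        ⟦ 2 ⟧ * ⟦ 2 ^ i ⟧ * b     ≡⟨ cong (_* b) (sym (⟦⟧-homo-* 2 (2 ^ i))) ⟩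
        ⟦ 2 ^ suc i ⟧ * b         ∎
        where open ≡-Reasoning

      weight′ : sum c ℕ.+ proj₂ (mergeStep (cl ++ [ W ]) x) ≡ sum cl ℕ.+ W ℕ.+ x
      weight′ = trans (mergeStep-weight (cl ++ [ W ]) x) (cong (ℕ._+ x) (sum-snoc cl W))

      B≤W+m : B ℚ.≤ ⟦ W ℕ.+ m ⟧
      B≤W+m = ≤-trans (<⇒≤ overflow) (⟦⟧-mono-≤ _ _ (ℕ.+-monoʳ-≤ W x≤m))

      merged-slack : MergeShape cl W c →
        ⟦ length c ⟧ * (⟦ 2 ⟧ * B) ℚ.≤ ⟦ sum c ℕ.+ (length c ℕ.+ suc i ℕ.* suc n) ℕ.* m ⟧
      merged-slack (all-paired sum≡ 2c≡) = begin
        ⟦ length c ⟧ * (⟦ 2 ⟧ * B)                  ≡⟨ double-bottleneck (length c) B ⟩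
        ⟦ 2 ℕ.* length c ⟧ * B                      ≡⟨ cong (λ k → ⟦ k ⟧ * B) 2c≡ ⟩
        ⟦ suc n ⟧ * B                               ≤⟨ close-slack n B (sum cl) W m K B≤W+m slack ⟩
        ⟦ sum cl ℕ.+ W ℕ.+ (suc n ℕ.+ K) ℕ.* m ⟧    ≤⟨ ⟦⟧-mono-≤ (sum cl ℕ.+ W ℕ.+ (suc n ℕ.+ K) ℕ.* m)
                                                        (sum c ℕ.+ (length c ℕ.+ (suc n ℕ.+ K)) ℕ.* m)
                                                        (ℕ.+-mono-≤ (ℕ.≤-reflexive (sym sum≡))
                                                          (ℕ.*-monoˡ-≤ m (ℕ.m≤n+m (suc n ℕ.+ K) (length c)))) ⟩
        ⟦ sum c ℕ.+ (length c ℕ.+ (suc n ℕ.+ K)) ℕ.* m ⟧ ∎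
        where open ≤-Reasoning
      merged-slack (open-left sum≡ 2c≡) = begin
        ⟦ length c ⟧ * (⟦ 2 ⟧ * B)                  ≡⟨ double-bottleneck (length c) B ⟩
        ⟦ 2 ℕ.* length c ⟧ * B                      ≡⟨ cong (λ k → ⟦ k ⟧ * B) 2c≡ ⟩
        ⟦ n ⟧ * B                                   ≤⟨ slack ⟩
        ⟦ sum cl ℕ.+ (n ℕ.+ K) ℕ.* m ⟧              ≤⟨ ⟦⟧-mono-≤ (sum cl ℕ.+ (n ℕ.+ K) ℕ.* m)
                                                        (sum c ℕ.+ (length c ℕ.+ (suc n ℕ.+ K)) ℕ.* m)
                                                        (ℕ.+-mono-≤ (ℕ.≤-reflexive (sym sum≡))
                                                          (ℕ.*-monoˡ-≤ m (ℕ.≤-trans (ℕ.n≤1+n (n ℕ.+ K))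
                                                            (ℕ.m≤n+m (suc n ℕ.+ K) (length c))))) ⟩
        ⟦ sum c ℕ.+ (length c ℕ.+ (suc n ℕ.+ K)) ℕ.* m ⟧ ∎
        where open ≤-Reasoning

      after′ : 0 ℕ.< suc i →
        ⟦ suc n ⟧ * (⟦ 2 ⟧ * B) ℚ.≤ ⟦ 2 ⟧ * ⟦ sum cl ℕ.+ W ℕ.+ x ℕ.+ suc i ℕ.* suc n ℕ.* m ⟧
      after′ _ = begin
        ⟦ suc n ⟧ * (⟦ 2 ⟧ * B)  ≡⟨ *-comm ⟦ suc n ⟧ (⟦ 2 ⟧ * B) ⟩
        ⟦ 2 ⟧ * B * ⟦ suc n ⟧    ≡⟨ *-assoc ⟦ 2 ⟧ B ⟦ suc n ⟧ ⟩
        ⟦ 2 ⟧ * (B * ⟦ suc n ⟧)  ≡⟨ cong (⟦ 2 ⟧ *_) (*-comm B ⟦ suc n ⟧) ⟩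
        ⟦ 2 ⟧ * (⟦ suc n ⟧ * B)  ≤⟨ *-monoˡ-≤-nonNeg ⟦ 2 ⟧ full ⟩
        ⟦ 2 ⟧ * ⟦ sum cl ℕ.+ W ℕ.+ x ℕ.+ suc i ℕ.* suc n ℕ.* m ⟧ ∎
        where
          open ≤-Reasoning
          full : ⟦ suc n ⟧ * B ℚ.≤ ⟦ sum cl ℕ.+ W ℕ.+ x ℕ.+ suc i ℕ.* suc n ℕ.* m ⟧
          full = ≤-trans (extend-slack n B (sum cl) ((n ℕ.+ K) ℕ.* m) (W ℕ.+ x) slack (<⇒≤ overflow))
                   (⟦⟧-mono-≤ _ _ (ℕ.+-mono-≤ (ℕ.≤-reflexive (sym (ℕ.+-assoc (sum cl) W x)))
                     (ℕ.*-monoˡ-≤ m (ℕ.+-monoˡ-≤ K (ℕ.n≤1+n n)))))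

  step-preserves : ∀ {S} s x → x ≤ m → Invariant p m b S s → Invariant p m b (S ℕ.+ x) (step p s x)
  step-preserves (st B cl W i) x x≤m I@(invariant _ few refl _ _)
    with ⟦ W ℕ.+ x ⟧ ≤ᵇ B in fits
  ... | true = fits-preserves x I
  ... | false with suc (length cl) <ᵇ p in room
  ...   | true  = close-preserves x x≤m (overflows B (W ℕ.+ x) fits) (ℕ.<ᵇ⇒< _ p (subst T (sym room) _)) I
  ...   | false = merge-preserves x x≤m (overflows B (W ℕ.+ x) fits) full I
    where
      full : suc (length cl) ≡ p
      full = ℕ.≤-antisym few (ℕ.≮⇒≥ (λ room′ → subst T room (ℕ.<⇒<ᵇ room′)))

  run-preserves : ∀ {S} s xs → All (ℕ._≤ m) xs → Invariant p m b S s →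
    Invariant p m b (S ℕ.+ sum xs) (runFrom p s xs)
  run-preserves {S} s []       []           I = subst (λ S′ → Invariant p m b S′ s) (sym (ℕ.+-identityʳ S)) I
  run-preserves {S} s (x ∷ xs) (x≤m ∷ xs≤m) I =
    subst (λ S′ → Invariant p m b S′ (runFrom p (step p s x) xs)) (ℕ.+-assoc S x (sum xs))
      (run-preserves (step p s x) xs xs≤m (step-preserves s x x≤m I))

last-merge-bound : ∀ p m i bstar S B → 0 ℕ.< p →
  ⟦ p ⟧ * B ℚ.≤ ⟦ 2 ⟧ * ⟦ S ℕ.+ i ℕ.* p ℕ.* m ⟧ → S ≤ p ℕ.* bstar →
  B ℚ.≤ ⟦ 2 ⟧ * (⟦ bstar ⟧ + ⟦ i ⟧ * ⟦ m ⟧)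
last-merge-bound p@(suc _) m i bstar S B _ merged S≤ =
  *-cancelˡ-≤-pos ⟦ p ⟧ {{normalize-pos p 1}} (begin
    ⟦ p ⟧ * B                                   ≤⟨ merged ⟩
    ⟦ 2 ⟧ * ⟦ S ℕ.+ i ℕ.* p ℕ.* m ⟧             ≤⟨ *-monoˡ-≤-nonNeg ⟦ 2 ⟧ (⟦⟧-mono-≤ _ _ total≤) ⟩
    ⟦ 2 ⟧ * ⟦ p ℕ.* (bstar ℕ.+ i ℕ.* m) ⟧       ≡⟨ cong (⟦ 2 ⟧ *_) (⟦⟧-homo-* p (bstar ℕ.+ i ℕ.* m)) ⟩
    ⟦ 2 ⟧ * (⟦ p ⟧ * ⟦ bstar ℕ.+ i ℕ.* m ⟧)     ≡⟨ *-comm-middle ⟦ 2 ⟧ ⟦ p ⟧ _ ⟩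
    ⟦ p ⟧ * (⟦ 2 ⟧ * ⟦ bstar ℕ.+ i ℕ.* m ⟧)     ≡⟨ cong (λ y → ⟦ p ⟧ * (⟦ 2 ⟧ * y))
                                                     (trans (⟦⟧-homo-+ bstar (i ℕ.* m)) (cong (⟦ bstar ⟧ +_) (⟦⟧-homo-* i m))) ⟩
    ⟦ p ⟧ * (⟦ 2 ⟧ * (⟦ bstar ⟧ + ⟦ i ⟧ * ⟦ m ⟧)) ∎)
  where
    open ≤-Reasoning
    spread : ∀ p b i m → p ℕ.* b ℕ.+ i ℕ.* p ℕ.* m ≡ p ℕ.* (b ℕ.+ i ℕ.* m)
    spread = solve-∀
    total≤ : S ℕ.+ i ℕ.* p ℕ.* m ≤ p ℕ.* (bstar ℕ.+ i ℕ.* m)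
    total≤ = ℕ.≤-trans (ℕ.+-monoˡ-≤ (i ℕ.* p ℕ.* m) S≤) (ℕ.≤-reflexive (spread p bstar i m))
    *-comm-middle : ∀ a b c → a * (b * c) ≡ b * (a * c)
    *-comm-middle a b c = trans (sym (*-assoc a b c)) (trans (cong (_* c) (*-comm a b)) (*-assoc b a c))

ℚ-ring : AlmostCommutativeRing _ _
ℚ-ring = fromCommutativeRing +-*-commutativeRing is-zero
  where
    is-zero : ∀ x → Maybe (0ℚ ≡ x)
    is-zero x with 0ℚ ≟ x
    ... | yes 0≡x = just 0≡x
    ... | no _    = nothing

nonNeg-* : ∀ {x y} → 0ℚ ℚ.≤ x → 0ℚ ℚ.≤ y → 0ℚ ℚ.≤ x * y
nonNeg-* {x} {y} 0≤x 0≤y =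
  nonNegative⁻¹ _ {{nonNeg*nonNeg⇒nonNeg x {{nonNegative 0≤x}} y {{nonNegative 0≤y}}}}

nonNeg-+ : ∀ {x y} → 0ℚ ℚ.≤ x → 0ℚ ℚ.≤ y → 0ℚ ℚ.≤ x + y
nonNeg-+ 0≤x 0≤y = +-mono-≤ 0≤x 0≤y

scaled-optimum : ∀ M a I P bs → 0ℚ ℚ.≤ M → 0ℚ ℚ.≤ a →
  P * (M * (1ℚ + a)) ℚ.≤ bs + I * M → M * (P * (1ℚ + a) - I - a) ℚ.≤ bs
scaled-optimum M a I P bs 0≤M 0≤a h = begin
  M * D                      ≡⟨ sym (+-identityʳ (M * D)) ⟩
  M * D + 0ℚ                 ≤⟨ +-monoʳ-≤ (M * D) (nonNeg-* 0≤a 0≤M) ⟩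
  M * D + a * M              ≡⟨ expand M a I P ⟩
  P * (M * (1ℚ + a)) - I * M ≤⟨ +-monoˡ-≤ (- (I * M)) h ⟩
  bs + I * M - I * M         ≡⟨ cancel bs (I * M) ⟩
  bs                         ∎
  where
    open ≤-Reasoning
    D : ℚ
    D = P * (1ℚ + a) - I - a
    expand : ∀ M a I P → M * (P * (1ℚ + a) - I - a) + a * M ≡ P * (M * (1ℚ + a)) - I * M
    expand = solve-∀-in ℚ-ring
    cancel : ∀ x y → x + y - y ≡ x
    cancel = solve-∀-in ℚ-ring

-- Writing t·P·M(1+a) = t·M·D + t(a + I)·M and bounding M ≤ B*/D
-- (from M·D ≤ B*) gives the competitive ratio t + t(a + I)/D.
ratio-bound : ∀ t a I P M bs → 0ℚ ℚ.≤ t → 0ℚ ℚ.≤ a → 0ℚ ℚ.≤ I →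
  (D>0 : 0ℚ ℚ.< P * (1ℚ + a) - I - a) →
  M * (P * (1ℚ + a) - I - a) ℚ.≤ bs →
  t * (P * (M * (1ℚ + a))) ℚ.≤ (t + (t * (a + I)) * (1/_ (P * (1ℚ + a) - I - a)) {{>-nonZero D>0}}) * bs
ratio-bound t a I P M bs 0≤t 0≤a 0≤I D>0 MD≤ = begin
  t * (P * (M * (1ℚ + a)))                 ≡⟨ split t a I M P ⟩
  t * (M * D) + t * (a + I) * M * 1ℚ       ≡⟨ cong (λ y → t * (M * D) + t * (a + I) * M * y)
                                                 (sym (*-inverseˡ D {{>-nonZero D>0}})) ⟩
  t * (M * D) + t * (a + I) * M * (q * D)  ≡⟨ sym (factor t a I q M D) ⟩
  c * (M * D)                              ≤⟨ *-monoˡ-≤-nonNeg c {{nonNegative 0≤c}} MD≤ ⟩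
  c * bs                                   ∎
  where
    open ≤-Reasoning
    D q c : ℚ
    D = P * (1ℚ + a) - I - a
    q = (1/ D) {{>-nonZero D>0}}
    c = t + (t * (a + I)) * q
    0≤c : 0ℚ ℚ.≤ c
    0≤c = nonNeg-+ 0≤t (nonNeg-* (nonNeg-* 0≤t (nonNeg-+ 0≤a 0≤I))
            (<⇒≤ (positive⁻¹ q {{1/pos⇒pos D {{positive D>0}}}})))
    split : ∀ t a I M P →
      t * (P * (M * (1ℚ + a))) ≡ t * (M * (P * (1ℚ + a) - I - a)) + t * (a + I) * M * 1ℚ
    split = solve-∀-in ℚ-ring
    factor : ∀ t a I q M D → (t + (t * (a + I)) * q) * (M * D) ≡ t * (M * D) + t * (a + I) * M * (q * D)
    factor = solve-∀-in ℚ-ring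

lemma5 : (m p : ℕ) (α : ℚ) (X : List ℕ) (i : ℕ) (bstar : ℕ) →
    2 ≤ p → 0ℚ ℚ.≤ α → α ℚ.< 1ℚ → IsMax m X →
    numMerges m p α X ≡ i → 2 ≤ i →
    IsOptimalBottleneck X p bstar →
    (D>0 : 0ℚ ℚ.< ⟦ 2 ^ (i ∸ 1) ⟧ * (1ℚ + α) - ⟦ i ⟧ - α) →
    outputB m p α X ℚ.≤
      (⟦ 2 ⟧ + (⟦ 2 ⟧ * (α + ⟦ i ⟧)) *
        (1/_ (⟦ 2 ^ (i ∸ 1) ⟧ * (1ℚ + α) - ⟦ i ⟧ - α) {{>-nonZero D>0}}))
      * ⟦ bstar ⟧
lemma5 m p α X i@(suc (suc j)) bstar 2≤p 0≤α _ (_ , bounded) merges≡i (s≤s (s≤s z≤n)) ((P , bottleneck≡) , _) D>0 =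
  begin
    outputB m p α X                      ≡⟨ output≡ ⟩
    ⟦ 2 ⟧ * (⟦ 2 ^ suc j ⟧ * b)          ≤⟨ ratio-bound ⟦ 2 ⟧ α ⟦ i ⟧ ⟦ 2 ^ suc j ⟧ ⟦ m ⟧ ⟦ bstar ⟧
                                              (⟦⟧-nonNeg 2) 0≤α (⟦⟧-nonNeg i) D>0
                                              (scaled-optimum ⟦ m ⟧ α ⟦ i ⟧ ⟦ 2 ^ suc j ⟧ ⟦ bstar ⟧
                                                (⟦⟧-nonNeg m) 0≤α halved) ⟩
    _                                    ∎
  where
    open ≤-Reasoning
    b : ℚ
    b = ⟦ m ⟧ * (1ℚ + α)
    0<p : 0 ℕ.< p
    0<p = ℕ.≤-trans (s≤s z≤n) 2≤p
    I : Invariant p m b (0 ℕ.+ sum X) (probeExtB m p α X)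
    I = run-preserves (initState m α) X bounded (initial-invariant p m α 0<p)
    output≡ : outputB m p α X ≡ ⟦ 2 ⟧ * (⟦ 2 ^ suc j ⟧ * b)
    output≡ = begin-equality
      outputB m p α X                ≡⟨ Invariant.doubling I ⟩
      ⟦ 2 ^ numMerges m p α X ⟧ * b  ≡⟨ cong (λ k → ⟦ 2 ^ k ⟧ * b) merges≡i ⟩
      ⟦ 2 ℕ.* 2 ^ suc j ⟧ * b        ≡⟨ cong (_* b) (⟦⟧-homo-* 2 (2 ^ suc j)) ⟩
      ⟦ 2 ⟧ * ⟦ 2 ^ suc j ⟧ * b      ≡⟨ *-assoc ⟦ 2 ⟧ ⟦ 2 ^ suc j ⟧ b ⟩
      ⟦ 2 ⟧ * (⟦ 2 ^ suc j ⟧ * b)    ∎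
    after-last-merge : ⟦ p ⟧ * outputB m p α X ℚ.≤ ⟦ 2 ⟧ * ⟦ sum X ℕ.+ i ℕ.* p ℕ.* m ⟧
    after-last-merge = subst (λ k → ⟦ p ⟧ * outputB m p α X ℚ.≤ ⟦ 2 ⟧ * ⟦ sum X ℕ.+ k ℕ.* p ℕ.* m ⟧)
      merges≡i (Invariant.after-merge I (subst (0 ℕ.<_) (sym merges≡i) (s≤s z≤n)))
    halved : ⟦ 2 ^ suc j ⟧ * b ℚ.≤ ⟦ bstar ⟧ + ⟦ i ⟧ * ⟦ m ⟧
    halved = *-cancelˡ-≤-pos ⟦ 2 ⟧ (subst (ℚ._≤ ⟦ 2 ⟧ * (⟦ bstar ⟧ + ⟦ i ⟧ * ⟦ m ⟧)) output≡
      (last-merge-bound p m i bstar (sum X) (outputB m p α X) 0<p after-last-merge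
        (subst (λ B → sum X ≤ p ℕ.* B) bottleneck≡ (sum≤p*bottleneck P))))
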